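{- Let $q$ be a power of a prime $p$, let $z\in\mathbb{F}_q^*$, and write $x^2+x-z=(x-r_1)(x-r_2)$ with $r_1,r_2\in\mathbb{F}_{q^2}$. Then, in $\mathbb{F}_q$, \[ \sum_{0\le k\le q/2}\binom{ -k}{k} z^k= \begin{cases} 1/2 & \text{if } r_1=r_2\in\mathbb{F}_q,\\ 1 & \text{if } r_1,r_2\in\mathbb{F}_q,\ r_1\ne r_2,\\ 0 & \text{if } r_1,r_2\notin\mathbb{F}_q. \end{cases} \]
   Context: For an integer $m$ and integer $a\ge 0$, $\binom{m}{a}=m(m-1)\cdots(m-a+1)/a!\in\mathbb{Z}$ (generalized binomial coefficient), and in the sum it is regarded as an element of the prime field $\mathbb{F}_p\subseteq\mathbb{F}_q$ by reduction modulo $p$. -}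

module Defs where

open import Level using (0ℓ)
open import Data.Nat as ℕ using (ℕ; zero; suc; _!; _∸_)
open import Data.Nat.Properties using (_!≢0)
open import Data.Integer as ℤ using (ℤ; +_; -[1+_]; _/ℕ_)
open import Data.Fin using (Fin)
open import Data.List using (List; upTo; map; foldr)
open import Data.Product using (Σ; _×_)
open import Relation.Binary.PropositionalEquality using (_≡_)
open import Relation.Nullary using (¬_)
open import Algebra.Structures using (IsCommutativeRing)
open import Function.Bundles using (_↔_)
open import Data.Nat.Primality using (Prime)

record Field : Set₁ where
  infixl 7 _*_
  infixl 6 _+_
  field
    Carrier : Set
    _+_ _*_ : Carrier → Carrier → Carrier
    -_ : Carrier → Carrier
    0# 1# : Carrier
    isCommutativeRing : IsCommutativeRing _≡_ _+_ _*_ -_ 0# 1#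
    0≢1 : ¬ (0# ≡ 1#)
    inverse : (x : Carrier) → ¬ (x ≡ 0#) → Σ Carrier (λ y → x * y ≡ 1#)

  fromℕ : ℕ → Carrier
  fromℕ zero = 0#
  fromℕ (suc n) = 1# + fromℕ n

  fromℤ : ℤ → Carrier
  fromℤ (+ n) = fromℕ n
  fromℤ -[1+ n ] = - fromℕ (suc n)

  _^_ : Carrier → ℕ → Carrier
  x ^ zero = 1#
  x ^ suc n = x * (x ^ n)

  sumUpTo : ℕ → (ℕ → Carrier) → Carrier
  sumUpTo n f = foldr _+_ 0# (map f (upTo n))

fallingFactorial : ℤ → ℕ → ℤ
fallingFactorial m zero = + 1
fallingFactorial m (suc a) = fallingFactorial m a ℤ.* (m ℤ.- + a)

-- generalized binomial coefficient  binom(m, a) = m(m-1)...(m-a+1)/a!  (exact division)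
gbinom : ℤ → ℕ → ℤ
gbinom m a = _/ℕ_ (fallingFactorial m a) (a !) {{a !≢0}}

record IsFiniteField (F : Field) (p q : ℕ) : Set where
  open Field F
  field
    p-prime : Prime p
    char-p : fromℕ p ≡ 0#
    exponent : ℕ
    exponent-pos : 1 ℕ.≤ exponent
    q≡p^n : q ≡ p ℕ.^ exponent
    enumeration : Fin q ↔ Carrier

{-# OPTIONS --safe #-}
-- Work in E = F[τ]/(τ² − τ − z). The τ-coordinate of τ^(n+1) is the Fibonacci-type polynomial
-- f_n = Σ_k C(n − k, k) z^k, and modulo p one has binom(−k, k) ≡ C(q − k, k) for k < q (Vandermonde,
-- with p ∣ C(q, j) for 0 < j < q); so the sum is f_q, the τ-coordinate of τ · τ^q, and everything
-- reduces to computing τ^q. If r ∈ F satisfies r² + r − z = 0, then w = τ + r satisfies w² = (1 + 2r) w,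
-- and since x ↦ x^q is additive and fixes F, τ^q = (1 + 2r)^(q−1) w − r. The sum is then
-- (1 + 2r)^(q−1) (1 + r) − r, which is −r = 1/2 for a double root (1 + 2r = 0) and 1 for distinct roots
-- (Fermat). Without roots the norm shows that E is an integral domain; τ^q is again a root of
-- X² − X − z = (X − τ)(X − (1 − τ)), and τ^q ≠ τ because X^q − X cannot have the q + 1 roots F ∪ {τ};
-- hence τ^q = 1 − τ and the sum is 0.
module Submission where

open import Defs
open import Level using (0ℓ)
open import Data.Nat as ℕ using (ℕ; zero; suc; _∸_; _≤_; _<_; s≤s; z≤n; _/_; NonZero)
import Data.Nat.Properties as ℕP
open import Data.Nat.Combinatorics using (_C_; nCn≡1; k>n⇒nCk≡0)
open import Data.Nat.DivMod using (m/n<m; m/n≤m)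
open import Data.Nat.Divisibility using (_∣_; divides)
open import Data.Nat.Primality using (Prime; prime⇒nonZero; prime⇒nonTrivial)
open import Data.Integer as ℤ using (ℤ; +_; -[1+_])
import Data.Integer.Properties as ℤP
open import Data.Fin as Fin using (Fin; toℕ; inject₁)
import Data.Fin.Properties as FinP
open import Data.List using (List; []; _∷_; length; replicate; applyUpTo; map; foldr)
open import Data.List.Properties using (length-replicate)
open import Data.Maybe using (Maybe; just; nothing)
open import Data.Product using (_×_; _,_; proj₁; proj₂)
open import Data.Sum using (inj₁; inj₂)
open import Data.Empty using (⊥-elim)
open import Data.Vec.Functional using (init; tail)
open import Function using (_∘_; Inverse; Injection; _↔_; mk↔ₛ′)
open import Function.Definitions using (Injective)
open import Function.Properties.Inverse using (↔-sym; ↔-trans; ↔⇒↣)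
open import Algebra.Bundles using (CommutativeRing)
open import Algebra.Structures using (IsCommutativeRing)
open import Algebra.Solver.Ring.AlmostCommutativeRing using (fromCommutativeRing; _-Raw-AlmostCommutative⟶_)
open import Relation.Binary.PropositionalEquality
open import Relation.Binary.Definitions using (DecidableEquality)
open import Relation.Nullary using (¬_; yes; no)
open import Relation.Nullary.Decidable using (via-injection)

module BinomialArithmetic where

  open import Data.Nat
  open import Data.Nat.Properties
  open import Data.Nat.Combinatorics using (nCk+nC[k+1]≡[n+1]C[k+1]; nC1≡n)
  open import Data.Nat.Divisibility
  open import Data.Nat.DivMod using (m≡m%n+[m/n]*n; m%n<n; m*n/n≡m; m*n%n≡0)
  open import Data.Nat.Primality using (euclidsLemma)
  open import Data.Nat.Tactic.RingSolver using (solve-∀)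
  open import Data.Integer using (-1ℤ; _/ℕ_)
  import Data.Integer.Tactic.RingSolver as ℤ-Solver

  [1+n]C[1+k]≡nC[1+k]+nCk : ∀ n k → suc n C suc k ≡ n C suc k + n C k
  [1+n]C[1+k]≡nC[1+k]+nCk n k = trans (sym (nCk+nC[k+1]≡[n+1]C[k+1] n k)) (+-comm (n C k) _)

  [1+n∸k]C[1+k]≡[n∸k]C[1+k]+[n∸k]Ck : ∀ n k → (suc n ∸ k) C suc k ≡ (n ∸ k) C suc k + (n ∸ k) C k
  [1+n∸k]C[1+k]≡[n∸k]C[1+k]+[n∸k]Ck n zero = [1+n]C[1+k]≡nC[1+k]+nCk n 0
  [1+n∸k]C[1+k]≡[n∸k]C[1+k]+[n∸k]Ck n (suc k) with suc k ≤? n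
  ... | yes k<n rewrite +-∸-assoc 1 k<n = [1+n]C[1+k]≡nC[1+k]+nCk (n ∸ suc k) (suc k)
  ... | no  k≮n rewrite m≤n⇒m∸n≡0 (≤-pred (≰⇒> k≮n)) | m≤n⇒m∸n≡0 (≤-trans (≤-pred (≰⇒> k≮n)) (n≤1+n k)) = refl

  [1+k]*[1+n]C[1+k]≡[1+n]*nCk : ∀ n k → suc k * (suc n C suc k) ≡ suc n * (n C k)
  [1+k]*[1+n]C[1+k]≡[1+n]*nCk zero    zero    = refl
  [1+k]*[1+n]C[1+k]≡[1+n]*nCk zero    (suc k) = *-zeroʳ (2 + k)
  [1+k]*[1+n]C[1+k]≡[1+n]*nCk (suc n) zero    = trans (+-identityʳ _) (trans (nC1≡n (2 + n)) (sym (*-identityʳ _)))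
  [1+k]*[1+n]C[1+k]≡[1+n]*nCk (suc n) (suc k) = begin
    (2 + k) * ((2 + n) C (2 + k))
      ≡⟨ cong ((2 + k) *_) ([1+n]C[1+k]≡nC[1+k]+nCk (suc n) (suc k)) ⟩
    (2 + k) * ((1 + n) C (2 + k) + (1 + n) C (1 + k))              ≡⟨ *-distribˡ-+ (2 + k) ((1 + n) C (2 + k)) _ ⟩
    (2 + k) * ((1 + n) C (2 + k)) + ((1 + n) C (1 + k) + (1 + k) * ((1 + n) C (1 + k)))
      ≡⟨ cong₂ (λ a b → a + ((1 + n) C (1 + k) + b)) ([1+k]*[1+n]C[1+k]≡[1+n]*nCk n (suc k)) ([1+k]*[1+n]C[1+k]≡[1+n]*nCk n k) ⟩
    (1 + n) * (n C (1 + k)) + ((1 + n) C (1 + k) + (1 + n) * (n C k))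
      ≡⟨ cong (λ a → (1 + n) * (n C (1 + k)) + (a + (1 + n) * (n C k))) ([1+n]C[1+k]≡nC[1+k]+nCk n k) ⟩
    (1 + n) * (n C (1 + k)) + ((n C (1 + k) + n C k) + (1 + n) * (n C k)) ≡⟨ regroup n (n C (1 + k)) (n C k) ⟩
    (2 + n) * (n C (1 + k) + n C k)                                ≡⟨ cong ((2 + n) *_) (sym ([1+n]C[1+k]≡nC[1+k]+nCk n k)) ⟩
    (2 + n) * ((1 + n) C (1 + k))                                  ∎
    where
    open ≡-Reasoning
    regroup : ∀ n a b → (1 + n) * a + ((a + b) + (1 + n) * b) ≡ (2 + n) * (a + b)
    regroup = solve-∀

  p^e∣j*c⇒p^e∣j : ∀ {p c} → Prime p → ¬ p ∣ c → ∀ e j → p ^ e ∣ j * c → p ^ e ∣ j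
  p^e∣j*c⇒p^e∣j p-prime p∤c zero    j _ = 1∣ j
  p^e∣j*c⇒p^e∣j {p} {c} p-prime p∤c (suc e) j p^[1+e]∣jc
    with euclidsLemma j c p-prime (∣-trans (m∣m*n (p ^ e)) p^[1+e]∣jc)
  ... | inj₂ p∣c = ⊥-elim (p∤c p∣c)
  ... | inj₁ (divides j′ refl) = subst (_∣ j′ * p) (*-comm (p ^ e) p) (*-monoˡ-∣ p p^e∣j′)
    where
    instance
      p≢0 : NonZero p
      p≢0 = prime⇒nonZero p-prime
    p^e∣j′ : p ^ e ∣ j′
    p^e∣j′ = p^e∣j*c⇒p^e∣j p-prime p∤c e j′ (*-cancelˡ-∣ p (subst (p * p ^ e ∣_) (regroup j′ p c) p^[1+e]∣jc))
      where
      regroup : ∀ j p c → j * p * c ≡ p * (j * c)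
      regroup = solve-∀

  p∣[p^e]Cj : ∀ {p} → Prime p → ∀ e j → 0 < j → j < p ^ e → p ∣ (p ^ e) C j
  p∣[p^e]Cj {p} p-prime e (suc j) 0<j j<q with p ∣? ((p ^ e) C suc j)
  ... | yes p∣C = p∣C
  ... | no  p∤C = ⊥-elim (<⇒≱ j<q (∣⇒≤ (p^e∣j*c⇒p^e∣j p-prime p∤C e (suc j) (q∣[1+j]*qC[1+j] (p ^ e) j<q))))
    where
    q∣[1+j]*qC[1+j] : ∀ q → suc j < q → q ∣ suc j * (q C suc j)
    q∣[1+j]*qC[1+j] (suc n) _ = divides (n C j) (trans ([1+k]*[1+n]C[1+k]≡[1+n]*nCk n j) (*-comm (suc n) _))

  [m/2<k]⇒m∸k<k : ∀ m k → m / 2 < k → m ∸ k < k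
  [m/2<k]⇒m∸k<k m k@(suc _) h<k = m<n+o⇒m∸n<o m k (begin-strict
    m                      ≡⟨ m≡m%n+[m/n]*n m 2 ⟩
    m % 2 + m / 2 * 2      ≤⟨ +-monoˡ-≤ (m / 2 * 2) (≤-pred (m%n<n m 2)) ⟩
    1 + m / 2 * 2          <⟨ ≤-reflexive (regroup (m / 2)) ⟩
    suc (m / 2) + suc (m / 2) ≤⟨ +-mono-≤ h<k h<k ⟩
    k + k                  ∎)
    where
    open ≤-Reasoning
    regroup : ∀ h → 2 + h * 2 ≡ suc h + suc h
    regroup = solve-∀

  -[1+m]/ℕd : ∀ m d .{{_ : NonZero d}} → suc m ℕ.% d ≡ 0 → -[1+ m ] /ℕ d ≡ ℤ.- + (suc m ℕ./ d)
  -[1+m]/ℕd m d d∣[1+m] with suc m ℕ.% d | d∣[1+m]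
  ... | zero | _ = refl

  *-/ℕ-cancelʳ : ∀ i d .{{_ : NonZero d}} → (i ℤ.* + d) /ℕ d ≡ i
  *-/ℕ-cancelʳ (+ n) d = begin
    (+ n ℤ.* + d) /ℕ d      ≡⟨ cong (_/ℕ d) (sym (ℤP.pos-* n d)) ⟩
    + (n ℕ.* d ℕ./ d)       ≡⟨ cong +_ (m*n/n≡m n d) ⟩
    + n                     ∎
    where open ≡-Reasoning
  *-/ℕ-cancelʳ -[1+ n ] d@(suc d′) = begin
    (-[1+ n ] ℤ.* + d) /ℕ d         ≡⟨ cong (_/ℕ d) (sym (ℤP.neg-distribˡ-* (+ suc n) (+ d))) ⟩
    (ℤ.- (+ suc n ℤ.* + d)) /ℕ d    ≡⟨ cong (λ i → ℤ.- i /ℕ d) (sym (ℤP.pos-* (suc n) d)) ⟩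
    -[1+ d′ ℕ.+ n ℕ.* d ] /ℕ d       ≡⟨ -[1+m]/ℕd (d′ ℕ.+ n ℕ.* d) d (m*n%n≡0 (suc n) d) ⟩
    ℤ.- + (suc n ℕ.* d ℕ./ d)       ≡⟨ cong (λ m → ℤ.- + m) (m*n/n≡m (suc n) d) ⟩
    -[1+ n ]                        ∎
    where open ≡-Reasoning

  -[1+n]-k≡-[1+n+k] : ∀ n k → -[1+ n ] ℤ.- + k ≡ ℤ.- + suc (n ℕ.+ k)
  -[1+n]-k≡-[1+n+k] n zero    = cong -[1+_] (sym (+-identityʳ n))
  -[1+n]-k≡-[1+n+k] n (suc k) = cong -[1+_] (sym (+-suc n k))

  fallingFactorial-neg : ∀ n k → fallingFactorial -[1+ n ] k ≡ (-1ℤ ℤ.^ k ℤ.* + ((n ℕ.+ k) C k)) ℤ.* + (k !)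
  fallingFactorial-neg n zero    = refl
  fallingFactorial-neg n (suc k) = begin
    fallingFactorial -[1+ n ] k ℤ.* (-[1+ n ] ℤ.- + k)
      ≡⟨ cong₂ ℤ._*_ (fallingFactorial-neg n k) (-[1+n]-k≡-[1+n+k] n k) ⟩
    (s ℤ.* + a) ℤ.* + (k !) ℤ.* ℤ.- + N           ≡⟨ regroup₁ s (+ a) (+ (k !)) (+ N) ⟩
    ℤ.- (s ℤ.* + (k !)) ℤ.* (+ N ℤ.* + a)          ≡⟨ cong (ℤ.- (s ℤ.* + (k !)) ℤ.*_) absorb ⟩
    ℤ.- (s ℤ.* + (k !)) ℤ.* (+ suc k ℤ.* + b)      ≡⟨ regroup₂ s (+ b) (+ (k !)) (+ suc k) ⟩
    (-1ℤ ℤ.* s ℤ.* + b) ℤ.* (+ suc k ℤ.* + (k !))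
      ≡⟨ cong₂ (λ c m → (-1ℤ ℤ.* s ℤ.* + (c C suc k)) ℤ.* m) (sym (+-suc n k)) (sym (ℤP.pos-* (suc k) (k !))) ⟩
    (-1ℤ ℤ.^ suc k ℤ.* + ((n ℕ.+ suc k) C suc k)) ℤ.* + (suc k !) ∎
    where
    open ≡-Reasoning
    s : ℤ
    s = -1ℤ ℤ.^ k
    a N b : ℕ
    a = (n ℕ.+ k) C k
    N = suc (n ℕ.+ k)
    b = N C suc k
    absorb : + N ℤ.* + a ≡ + suc k ℤ.* + b
    absorb = trans (sym (ℤP.pos-* N a)) (trans (cong +_ (sym ([1+k]*[1+n]C[1+k]≡[1+n]*nCk (n ℕ.+ k) k))) (ℤP.pos-* (suc k) b))
    regroup₁ : ∀ s a f N → (s ℤ.* a) ℤ.* f ℤ.* ℤ.- N ≡ ℤ.- (s ℤ.* f) ℤ.* (N ℤ.* a)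
    regroup₁ = ℤ-Solver.solve-∀
    regroup₂ : ∀ s b f K → ℤ.- (s ℤ.* f) ℤ.* (K ℤ.* b) ≡ (-1ℤ ℤ.* s ℤ.* b) ℤ.* (K ℤ.* f)
    regroup₂ = ℤ-Solver.solve-∀

  gbinom-neg : ∀ n k → gbinom -[1+ n ] k ≡ -1ℤ ℤ.^ k ℤ.* + ((n ℕ.+ k) C k)
  gbinom-neg n k = trans (cong (λ i → _/ℕ_ i (k !) {{k !≢0}}) (fallingFactorial-neg n k))
                         (*-/ℕ-cancelʳ _ (k !) {{k !≢0}})

open BinomialArithmetic

module CommutativeRingTheory
  {R : Set} {add mul : R → R → R} {neg : R → R} {0ᴿ 1ᴿ : R}
  (isCommutativeRing : IsCommutativeRing _≡_ add mul neg 0ᴿ 1ᴿ) where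

  -- Module parameters cannot carry fixities, so the operations are used through this bundle.
  commutativeRing : CommutativeRing 0ℓ 0ℓ
  commutativeRing = record { isCommutativeRing = isCommutativeRing }

  open CommutativeRing commutativeRing using (ring; semiring; commutativeSemiring)
  open CommutativeRing commutativeRing public
    using ( _+_; _*_; -_; _-_; 0#; 1#; +-congˡ; +-congʳ; +-assoc; +-comm; +-identityˡ; +-identityʳ
          ; -‿inverseˡ; -‿inverseʳ; *-assoc; *-comm; *-identityˡ; *-identityʳ; distribˡ; distribʳ; zeroˡ; zeroʳ)
  open import Algebra.Properties.Ring ring public
    using (-‿distribˡ-*; -‿distribʳ-*; -‿involutive; -0#≈0#; -‿+-comm; ⁻¹-anti-homo‿-)
    renaming (x∙y⁻¹≈ε⇒x≈y to x-y≡0⇒x≡y; x≈y⇒x∙y⁻¹≈ε to x≡y⇒x-y≡0)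
  open import Algebra.Properties.Semiring.Exp semiring public using (_^_)
  open import Algebra.Properties.CommutativeSemiring.Exp commutativeSemiring public using (^-distrib-*)
  open import Algebra.Properties.Semiring.Mult semiring using (×-assoc-*) renaming (_×_ to _×ᵤ_)
  open import Algebra.Properties.Semiring.Mult.TCOptimised semiring
    using (×-homo-+; ×1-homo-*; 1+×; ×ᵤ≈×) renaming (_×_ to _×′_)
  open import Algebra.Properties.CommutativeSemiring.Binomial commutativeSemiring using (theorem; binomialTerm)
  open import Algebra.Properties.Monoid.Sum (CommutativeRing.+-monoid commutativeRing)
    using (sum; sum-init-last; sum-cong-≗; sum-replicate-zero)
  open ≡-Reasoning

  x≡-y⇒x+y≡0 : ∀ {x y} → x ≡ - y → x + y ≡ 0#
  x≡-y⇒x+y≡0 {y = y} x≡-y = trans (+-congʳ x≡-y) (-‿inverseˡ y)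

  x-0≡x : ∀ x → x - 0# ≡ x
  x-0≡x x = trans (+-congˡ -0#≈0#) (+-identityʳ x)

  x+y-y≡x : ∀ x y → (x + y) - y ≡ x
  x+y-y≡x x y = begin
    (x + y) - y    ≡⟨ +-assoc x y (- y) ⟩
    x + (y - y)    ≡⟨ +-congˡ (-‿inverseʳ y) ⟩
    x + 0#         ≡⟨ +-identityʳ x ⟩
    x              ∎

  -- Unlike Field.fromℕ, these send 0 and 1 to 0# and 1# definitionally, as the ring solver needs.
  fromℕ′ : ℕ → R
  fromℕ′ n = n ×′ 1#

  fromℕ′-suc : ∀ n → fromℕ′ (suc n) ≡ 1# + fromℕ′ n
  fromℕ′-suc n = 1+× n 1#

  fromℤ′ : ℤ → R
  fromℤ′ (+ n)    = fromℕ′ n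
  fromℤ′ -[1+ n ] = - fromℕ′ (suc n)

  fromℤ′-neg : ∀ i → fromℤ′ (ℤ.- i) ≡ - fromℤ′ i
  fromℤ′-neg (+ zero)  = sym -0#≈0#
  fromℤ′-neg (+ suc n) = refl
  fromℤ′-neg -[1+ n ]  = sym (-‿involutive _)

  fromℤ′-⊖ : ∀ m n → fromℤ′ (m ℤ.⊖ n) ≡ fromℕ′ m - fromℕ′ n
  fromℤ′-⊖ m n with ℕP.≤-total n m
  ... | inj₁ n≤m = begin
    fromℤ′ (m ℤ.⊖ n)                            ≡⟨ cong fromℤ′ (ℤP.⊖-≥ n≤m) ⟩
    fromℕ′ (m ∸ n)                              ≡⟨ sym (x+y-y≡x _ _) ⟩
    (fromℕ′ (m ∸ n) + fromℕ′ n) - fromℕ′ n      ≡⟨ cong (_- fromℕ′ n) (sym (×-homo-+ 1# (m ∸ n) n)) ⟩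
    fromℕ′ (m ∸ n ℕ.+ n) - fromℕ′ n             ≡⟨ cong (λ k → fromℕ′ k - fromℕ′ n) (ℕP.m∸n+n≡m n≤m) ⟩
    fromℕ′ m - fromℕ′ n                         ∎
  ... | inj₂ m≤n = begin
    fromℤ′ (m ℤ.⊖ n)                            ≡⟨ cong fromℤ′ (ℤP.⊖-≤ m≤n) ⟩
    fromℤ′ (ℤ.- + (n ∸ m))                      ≡⟨ fromℤ′-neg (+ (n ∸ m)) ⟩
    - fromℕ′ (n ∸ m)                            ≡⟨ cong -_ (sym (x+y-y≡x _ _)) ⟩
    - ((fromℕ′ (n ∸ m) + fromℕ′ m) - fromℕ′ m)  ≡⟨ cong (λ x → - (x - fromℕ′ m)) (sym (×-homo-+ 1# (n ∸ m) m)) ⟩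
    - (fromℕ′ (n ∸ m ℕ.+ m) - fromℕ′ m)         ≡⟨ cong (λ k → - (fromℕ′ k - fromℕ′ m)) (ℕP.m∸n+n≡m m≤n) ⟩
    - (fromℕ′ n - fromℕ′ m)                     ≡⟨ ⁻¹-anti-homo‿- (fromℕ′ n) (fromℕ′ m) ⟩
    fromℕ′ m - fromℕ′ n                         ∎

  fromℤ′-+ : ∀ i j → fromℤ′ (i ℤ.+ j) ≡ fromℤ′ i + fromℤ′ j
  fromℤ′-+ (+ m)    (+ n)    = ×-homo-+ 1# m n
  fromℤ′-+ (+ m)    -[1+ n ] = fromℤ′-⊖ m (suc n)
  fromℤ′-+ -[1+ m ] (+ n)    = trans (fromℤ′-⊖ n (suc m)) (+-comm _ _)
  fromℤ′-+ -[1+ m ] -[1+ n ] = begin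
    - fromℕ′ (suc (suc (m ℕ.+ n)))          ≡⟨ cong (λ k → - fromℕ′ (suc k)) (sym (ℕP.+-suc m n)) ⟩
    - fromℕ′ (suc m ℕ.+ suc n)              ≡⟨ cong -_ (×-homo-+ 1# (suc m) (suc n)) ⟩
    - (fromℕ′ (suc m) + fromℕ′ (suc n))     ≡⟨ sym (-‿+-comm _ _) ⟩
    - fromℕ′ (suc m) + - fromℕ′ (suc n)     ∎

  fromℤ′-*-+ : ∀ m j → fromℤ′ (+ m ℤ.* j) ≡ fromℕ′ m * fromℤ′ j
  fromℤ′-*-+ m (+ n) = trans (cong fromℤ′ (sym (ℤP.pos-* m n))) (×1-homo-* m n)
  fromℤ′-*-+ m -[1+ n ] = begin
    fromℤ′ (+ m ℤ.* -[1+ n ])         ≡⟨ cong fromℤ′ (sym (ℤP.neg-distribʳ-* (+ m) (+ suc n))) ⟩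
    fromℤ′ (ℤ.- (+ m ℤ.* + suc n))    ≡⟨ fromℤ′-neg (+ m ℤ.* + suc n) ⟩
    - fromℤ′ (+ m ℤ.* + suc n)        ≡⟨ cong -_ (fromℤ′-*-+ m (+ suc n)) ⟩
    - (fromℕ′ m * fromℕ′ (suc n))     ≡⟨ -‿distribʳ-* _ _ ⟩
    fromℕ′ m * - fromℕ′ (suc n)       ∎

  fromℤ′-* : ∀ i j → fromℤ′ (i ℤ.* j) ≡ fromℤ′ i * fromℤ′ j
  fromℤ′-* (+ m)    j = fromℤ′-*-+ m j
  fromℤ′-* -[1+ m ] j = begin
    fromℤ′ (-[1+ m ] ℤ.* j)           ≡⟨ cong fromℤ′ (sym (ℤP.neg-distribˡ-* (+ suc m) j)) ⟩
    fromℤ′ (ℤ.- (+ suc m ℤ.* j))      ≡⟨ fromℤ′-neg (+ suc m ℤ.* j) ⟩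
    - fromℤ′ (+ suc m ℤ.* j)          ≡⟨ cong -_ (fromℤ′-*-+ (suc m) j) ⟩
    - (fromℕ′ (suc m) * fromℤ′ j)     ≡⟨ -‿distribˡ-* _ _ ⟩
    - fromℕ′ (suc m) * fromℤ′ j       ∎

  fromℤ′-homomorphism : ℤ.+-*-rawRing -Raw-AlmostCommutative⟶ fromCommutativeRing commutativeRing
  fromℤ′-homomorphism = record
    { ⟦_⟧    = fromℤ′
    ; +-homo = fromℤ′-+
    ; *-homo = fromℤ′-*
    ; -‿homo = fromℤ′-neg
    ; 0-homo = refl
    ; 1-homo = refl
    }

  fromℤ′-≟ : ∀ i j → Maybe (fromℤ′ i ≡ fromℤ′ j)
  fromℤ′-≟ i j with i ℤP.≟ j
  ... | yes i≡j = just (cong fromℤ′ i≡j)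
  ... | no  _   = nothing

  open import Algebra.Solver.Ring ℤ.+-*-rawRing (fromCommutativeRing commutativeRing)
    fromℤ′-homomorphism fromℤ′-≟ public
    using (solve; _:=_; _:+_; _:*_; :-_; _:-_; con; Polynomial)

  :0 :1 : ∀ {n} → Polynomial n
  :0 = con (+ 0)
  :1 = con (+ 1)

  ∑ : ℕ → (ℕ → R) → R
  ∑ zero    f = 0#
  ∑ (suc n) f = f 0 + ∑ n (f ∘ suc)

  ∑-cong : ∀ n {f g} → (∀ k → k < n → f k ≡ g k) → ∑ n f ≡ ∑ n g
  ∑-cong zero    f≡g = refl
  ∑-cong (suc n) f≡g = cong₂ _+_ (f≡g 0 (s≤s z≤n)) (∑-cong n (λ k k<n → f≡g (suc k) (s≤s k<n)))

  ∑-zero : ∀ n {f} → (∀ k → k < n → f k ≡ 0#) → ∑ n f ≡ 0#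
  ∑-zero zero    f≡0 = refl
  ∑-zero (suc n) f≡0 = begin
    _ + ∑ n _    ≡⟨ cong₂ _+_ (f≡0 0 (s≤s z≤n)) (∑-zero n (λ k k<n → f≡0 (suc k) (s≤s k<n))) ⟩
    0# + 0#      ≡⟨ +-identityˡ 0# ⟩
    0#           ∎

  ∑-distrib-+ : ∀ n f g → ∑ n (λ k → f k + g k) ≡ ∑ n f + ∑ n g
  ∑-distrib-+ zero    f g = sym (+-identityˡ 0#)
  ∑-distrib-+ (suc n) f g = begin
    (f 0 + g 0) + ∑ n (λ k → f (suc k) + g (suc k))   ≡⟨ +-congˡ (∑-distrib-+ n (f ∘ suc) (g ∘ suc)) ⟩
    (f 0 + g 0) + (∑ n (f ∘ suc) + ∑ n (g ∘ suc))
      ≡⟨ solve 4 (λ a b c d → (a :+ b) :+ (c :+ d) := (a :+ c) :+ (b :+ d)) refl _ _ _ _ ⟩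
    (f 0 + ∑ n (f ∘ suc)) + (g 0 + ∑ n (g ∘ suc))    ∎

  *-distribˡ-∑ : ∀ n c f → c * ∑ n f ≡ ∑ n (λ k → c * f k)
  *-distribˡ-∑ zero    c f = zeroʳ c
  *-distribˡ-∑ (suc n) c f = trans (distribˡ c _ _) (+-congˡ (*-distribˡ-∑ n c (f ∘ suc)))

  ∑-extend : ∀ m n {f} → m ≤ n → (∀ k → m ≤ k → k < n → f k ≡ 0#) → ∑ m f ≡ ∑ n f
  ∑-extend zero    n       m≤n       f≡0 = sym (∑-zero n (λ k → f≡0 k z≤n))
  ∑-extend (suc m) (suc n) (s≤s m≤n) f≡0 =
    +-congˡ (∑-extend m n m≤n (λ k m≤k k<n → f≡0 (suc k) (s≤s m≤k) (s≤s k<n)))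

  choose : ℤ → ℕ → R
  choose (+ a)    k = fromℕ′ (a C k)
  choose -[1+ n ] k = (- 1#) ^ k * fromℕ′ ((n ℕ.+ k) C k)

  fromℤ′-^ : ∀ i k → fromℤ′ (i ℤ.^ k) ≡ fromℤ′ i ^ k
  fromℤ′-^ i zero    = refl
  fromℤ′-^ i (suc k) = trans (fromℤ′-* i (i ℤ.^ k)) (cong (fromℤ′ i *_) (fromℤ′-^ i k))

  fromℤ′-gbinom-neg : ∀ n k → fromℤ′ (gbinom -[1+ n ] k) ≡ choose -[1+ n ] k
  fromℤ′-gbinom-neg n k = begin
    fromℤ′ (gbinom -[1+ n ] k)                                ≡⟨ cong fromℤ′ (gbinom-neg n k) ⟩
    fromℤ′ (ℤ.-1ℤ ℤ.^ k ℤ.* + ((n ℕ.+ k) C k))                ≡⟨ fromℤ′-* (ℤ.-1ℤ ℤ.^ k) _ ⟩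
    fromℤ′ (ℤ.-1ℤ ℤ.^ k) * fromℕ′ ((n ℕ.+ k) C k)             ≡⟨ cong (_* fromℕ′ ((n ℕ.+ k) C k)) (fromℤ′-^ ℤ.-1ℤ k) ⟩
    (- 1#) ^ k * fromℕ′ ((n ℕ.+ k) C k)                       ∎

  choose-0 : ∀ m → choose m 0 ≡ 1#
  choose-0 (+ a)    = refl
  choose-0 -[1+ n ] = *-identityˡ (fromℕ′ ((n ℕ.+ 0) C 0))

  choose-pascal : ∀ m k → choose (ℤ.suc m) (suc k) ≡ choose m (suc k) + choose m k
  choose-pascal (+ a) k = trans (cong fromℕ′ ([1+n]C[1+k]≡nC[1+k]+nCk a k)) (×-homo-+ 1# (a C suc k) (a C k))
  choose-pascal -[1+ zero ] k = begin
    0#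
      ≡⟨ solve 1 (λ u → :0 := ((:- :1) :* u) :* :1 :+ u :* :1) refl ((- 1#) ^ k) ⟩
    (- 1# * (- 1#) ^ k) * 1# + (- 1#) ^ k * 1#
      ≡⟨ sym (cong₂ (λ a b → (- 1# * (- 1#) ^ k) * fromℕ′ a + (- 1#) ^ k * fromℕ′ b) (nCn≡1 (suc k)) (nCn≡1 k)) ⟩
    choose -[1+ zero ] (suc k) + choose -[1+ zero ] k ∎
  choose-pascal -[1+ suc n ] k = begin
    (- 1# * u) * fromℕ′ a
      ≡⟨ solve 3 (λ u a b → ((:- :1) :* u) :* a := ((:- :1) :* u) :* (a :+ b) :+ u :* b) refl u (fromℕ′ a) (fromℕ′ b) ⟩
    (- 1# * u) * (fromℕ′ a + fromℕ′ b) + u * fromℕ′ b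
      ≡⟨ cong₂ (λ x c → (- 1# * u) * x + u * fromℕ′ (c C k)) (trans (sym (×-homo-+ 1# a b)) (cong fromℕ′ (sym ([1+n]C[1+k]≡nC[1+k]+nCk (n ℕ.+ suc k) k)))) (ℕP.+-suc n k) ⟩
    choose -[1+ suc n ] (suc k) + choose -[1+ suc n ] k ∎
    where
    u : R
    u = (- 1#) ^ k
    a b : ℕ
    a = (n ℕ.+ suc k) C suc k
    b = (n ℕ.+ suc k) C k

  choose-vandermonde : ∀ N m k → choose (+ N ℤ.+ m) k ≡ ∑ (suc k) (λ j → fromℕ′ (N C j) * choose m (k ∸ j))
  choose-vandermonde zero m k = begin
    choose (+ 0 ℤ.+ m) k                                  ≡⟨ cong (λ i → choose i k) (ℤP.+-identityˡ m) ⟩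
    choose m k
      ≡⟨ sym (trans (+-congˡ (∑-zero k (λ j _ → zeroˡ _))) (trans (+-identityʳ _) (*-identityˡ _))) ⟩
    ∑ (suc k) (λ j → fromℕ′ (0 C j) * choose m (k ∸ j))   ∎
  choose-vandermonde (suc N) m zero = begin
    choose (+ suc N ℤ.+ m) 0                              ≡⟨ choose-0 (+ suc N ℤ.+ m) ⟩
    1#
      ≡⟨ sym (trans (+-identityʳ _) (trans (*-identityˡ _) (choose-0 m))) ⟩
    1# * choose m 0 + 0#                                  ∎
  choose-vandermonde (suc N) m (suc k) = begin
    choose (+ suc N ℤ.+ m) (suc k)                         ≡⟨ cong (λ i → choose i (suc k)) (ℤP.+-assoc (+ 1) (+ N) m) ⟩
    choose (ℤ.suc (+ N ℤ.+ m)) (suc k)                     ≡⟨ choose-pascal (+ N ℤ.+ m) k ⟩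
    choose (+ N ℤ.+ m) (suc k) + choose (+ N ℤ.+ m) k
      ≡⟨ cong₂ _+_ (choose-vandermonde N m (suc k)) (choose-vandermonde N m k) ⟩
    (1# * choose m (suc k) + ∑ (suc k) A) + ∑ (suc k) B    ≡⟨ +-assoc _ _ _ ⟩
    1# * choose m (suc k) + (∑ (suc k) A + ∑ (suc k) B)    ≡⟨ +-congˡ (sym (∑-distrib-+ (suc k) A B)) ⟩
    1# * choose m (suc k) + ∑ (suc k) (λ j → A j + B j)    ≡⟨ +-congˡ (∑-cong (suc k) (λ j _ → pascal-term j)) ⟩
    ∑ (suc (suc k)) (λ j → fromℕ′ (suc N C j) * choose m (suc k ∸ j)) ∎
    where
    A B : ℕ → R
    A j = fromℕ′ (N C suc j) * choose m (k ∸ j)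
    B j = fromℕ′ (N C j) * choose m (k ∸ j)
    pascal-term : ∀ j → A j + B j ≡ fromℕ′ (suc N C suc j) * choose m (k ∸ j)
    pascal-term j = begin
      A j + B j                                              ≡⟨ sym (distribʳ _ _ _) ⟩
      (fromℕ′ (N C suc j) + fromℕ′ (N C j)) * choose m (k ∸ j)
        ≡⟨ cong (_* choose m (k ∸ j)) (sym (×-homo-+ 1# (N C suc j) (N C j))) ⟩
      fromℕ′ (N C suc j ℕ.+ N C j) * choose m (k ∸ j)
        ≡⟨ cong (λ c → fromℕ′ c * choose m (k ∸ j)) (sym ([1+n]C[1+k]≡nC[1+k]+nCk N j)) ⟩
      fromℕ′ (suc N C suc j) * choose m (k ∸ j)                ∎

  module Characteristic {p : ℕ} (p-prime : Prime p) (char-p : fromℕ′ p ≡ 0#) where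

    fromℕ′-∣ : ∀ {n} → p ∣ n → fromℕ′ n ≡ 0#
    fromℕ′-∣ (divides d refl) = trans (×1-homo-* d p) (trans (cong (fromℕ′ d *_) char-p) (zeroʳ _))

    choose-periodic : ∀ e m k → k < p ℕ.^ e → choose (+ (p ℕ.^ e) ℤ.+ m) k ≡ choose m k
    choose-periodic e m k k<q = begin
      choose (+ (p ℕ.^ e) ℤ.+ m) k                                  ≡⟨ choose-vandermonde (p ℕ.^ e) m k ⟩
      1# * choose m k + ∑ k (λ j → fromℕ′ (p ℕ.^ e C suc j) * choose m (k ∸ suc j)) ≡⟨ +-congˡ (∑-zero k vanishing) ⟩
      1# * choose m k + 0#                                           ≡⟨ trans (+-identityʳ _) (*-identityˡ _) ⟩
      choose m k                                                     ∎
      where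
      vanishing : ∀ j → j < k → fromℕ′ (p ℕ.^ e C suc j) * choose m (k ∸ suc j) ≡ 0#
      vanishing j j<k = trans (cong (_* _) (fromℕ′-∣ (p∣[p^e]Cj p-prime e (suc j) (s≤s z≤n) (ℕP.≤-<-trans j<k k<q)))) (zeroˡ _)

    ^-distrib-+ : ∀ n → 0 < n → (∀ j → 0 < j → j < n → p ∣ n C j) → ∀ x y → (x + y) ^ n ≡ x ^ n + y ^ n
    ^-distrib-+ (suc n) _ p∣C x y = begin
      (x + y) ^ suc n                                                    ≡⟨ theorem (suc n) x y ⟩
      binomialTerm x y (suc n) Fin.zero + sum (tail (binomialTerm x y (suc n)))
        ≡⟨ cong₂ _+_ first (sum-init-last (tail (binomialTerm x y (suc n)))) ⟩
      y ^ suc n + (sum (init (tail (binomialTerm x y (suc n)))) + binomialTerm x y (suc n) (Fin.fromℕ (suc n)))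
        ≡⟨ +-congˡ (cong₂ _+_ (trans (sum-cong-≗ middle) (sum-replicate-zero n)) (last (suc n))) ⟩
      y ^ suc n + (0# + x ^ suc n)                                        ≡⟨ trans (+-congˡ (+-identityˡ _)) (+-comm _ _) ⟩
      x ^ suc n + y ^ suc n                                              ∎
      where
      first : binomialTerm x y (suc n) Fin.zero ≡ y ^ suc n
      first = trans (+-identityʳ _) (*-identityˡ _)
      last : ∀ m → binomialTerm x y m (Fin.fromℕ m) ≡ x ^ m
      last m rewrite FinP.toℕ-fromℕ m | nCn≡1 m | ℕP.n∸n≡0 m = trans (+-identityʳ _) (*-identityʳ _)
      middle : ∀ i → binomialTerm x y (suc n) (Fin.suc (inject₁ i)) ≡ 0#
      middle i = begin
        (suc n C j) ×ᵤ t           ≡⟨ cong ((suc n C j) ×ᵤ_) (sym (*-identityˡ t)) ⟩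
        (suc n C j) ×ᵤ (1# * t)    ≡⟨ sym (×-assoc-* (suc n C j) 1# t) ⟩
        ((suc n C j) ×ᵤ 1#) * t    ≡⟨ cong (_* t) (×ᵤ≈× (suc n C j) 1#) ⟩
        fromℕ′ (suc n C j) * t     ≡⟨ cong (_* t) (fromℕ′-∣ (p∣C j (s≤s z≤n) (s≤s j<n))) ⟩
        0# * t                     ≡⟨ zeroˡ t ⟩
        0#                         ∎
        where
        j : ℕ
        j = suc (toℕ (inject₁ i))
        t : R
        t = x ^ j * y ^ (suc n ∸ j)
        j<n : toℕ (inject₁ i) < n
        j<n = subst (_< n) (sym (FinP.toℕ-inject₁ i)) (FinP.toℕ<n i)

    frobenius : ∀ e x y → (x + y) ^ (p ℕ.^ e) ≡ x ^ (p ℕ.^ e) + y ^ (p ℕ.^ e)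
    frobenius e = ^-distrib-+ (p ℕ.^ e) (ℕP.m^n>0 p {{prime⇒nonZero p-prime}} e) (p∣[p^e]Cj p-prime e)

  fibonacci : R → ℕ → R
  fibonacci z n = ∑ (suc n) (λ k → fromℕ′ ((n ∸ k) C k) * z ^ k)

  fibonacci-0 : ∀ z → fibonacci z 0 ≡ 1#
  fibonacci-0 z = trans (+-identityʳ _) (*-identityˡ 1#)

  fibonacci-1 : ∀ z → fibonacci z 1 ≡ 1#
  fibonacci-1 z = solve 1 (λ z → :1 :* :1 :+ (:0 :* (z :* :1) :+ :0) := :1) refl z

  fibonacci-rec : ∀ z n → fibonacci z (suc (suc n)) ≡ fibonacci z (suc n) + z * fibonacci z n
  fibonacci-rec z n = begin
    t₀ + ∑ (suc (suc n)) (λ j → fromℕ′ ((suc n ∸ j) C suc j) * z ^ suc j)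
      ≡⟨ +-congˡ (∑-cong (suc (suc n)) (λ j _ → pascal-term j)) ⟩
    t₀ + ∑ (suc (suc n)) (λ j → A j + B j)                                ≡⟨ +-congˡ (∑-distrib-+ (suc (suc n)) A B) ⟩
    t₀ + (∑ (suc (suc n)) A + ∑ (suc (suc n)) B)
      ≡⟨ +-congˡ (sym (cong₂ _+_ (drop-last A-last) (drop-last B-last))) ⟩
    t₀ + (∑ (suc n) A + ∑ (suc n) B)                                       ≡⟨ sym (+-assoc _ _ _) ⟩
    fibonacci z (suc n) + ∑ (suc n) B
      ≡⟨ +-congˡ (∑-cong (suc n) (λ j _ → shift (fromℕ′ ((n ∸ j) C j)) (z ^ j))) ⟩
    fibonacci z (suc n) + ∑ (suc n) (λ j → z * T j)                        ≡⟨ +-congˡ (sym (*-distribˡ-∑ (suc n) z T)) ⟩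
    fibonacci z (suc n) + z * fibonacci z n                                ∎
    where
    t₀ : R
    t₀ = fromℕ′ 1 * 1#
    A B T : ℕ → R
    T j = fromℕ′ ((n ∸ j) C j) * z ^ j
    A j = fromℕ′ ((n ∸ j) C suc j) * z ^ suc j
    B j = fromℕ′ ((n ∸ j) C j) * z ^ suc j
    pascal-term : ∀ j → fromℕ′ ((suc n ∸ j) C suc j) * z ^ suc j ≡ A j + B j
    pascal-term j = begin
      fromℕ′ ((suc n ∸ j) C suc j) * z ^ suc j
        ≡⟨ cong (λ c → fromℕ′ c * z ^ suc j) ([1+n∸k]C[1+k]≡[n∸k]C[1+k]+[n∸k]Ck n j) ⟩
      fromℕ′ ((n ∸ j) C suc j ℕ.+ (n ∸ j) C j) * z ^ suc j
        ≡⟨ cong (_* z ^ suc j) (×-homo-+ 1# ((n ∸ j) C suc j) ((n ∸ j) C j)) ⟩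
      (fromℕ′ ((n ∸ j) C suc j) + fromℕ′ ((n ∸ j) C j)) * z ^ suc j  ≡⟨ distribʳ _ _ _ ⟩
      A j + B j                                                     ∎
    drop-last : ∀ {f} → (∀ k → n < k → k < suc (suc n) → f k ≡ 0#) → ∑ (suc n) f ≡ ∑ (suc (suc n)) f
    drop-last = ∑-extend (suc n) (suc (suc n)) (ℕP.n≤1+n _)
    A-last : ∀ k → n < k → k < suc (suc n) → A k ≡ 0#
    A-last k n<k _ rewrite ℕP.m≤n⇒m∸n≡0 (ℕP.<⇒≤ n<k) = zeroˡ _
    B-last : ∀ k → n < k → k < suc (suc n) → B k ≡ 0#
    B-last (suc k) n<k _ rewrite ℕP.m≤n⇒m∸n≡0 (ℕP.<⇒≤ n<k) = zeroˡ _
    shift : ∀ c w → c * (z * w) ≡ z * (c * w)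
    shift c w = solve 3 (λ c w z → c :* (z :* w) := z :* (c :* w)) refl c w z

  evalMonic : List R → R → R
  evalMonic []      x = 1#
  evalMonic (a ∷ f) x = a + x * evalMonic f x

  evalMonic-replicate : ∀ m x → evalMonic (replicate m 0#) x ≡ x ^ m
  evalMonic-replicate zero    x = refl
  evalMonic-replicate (suc m) x = trans (+-identityˡ _) (cong (x *_) (evalMonic-replicate m x))

  evalMonic-X^[2+m]-X : ∀ m x → evalMonic (0# ∷ - 1# ∷ replicate m 0#) x ≡ x ^ (2 ℕ.+ m) - x
  evalMonic-X^[2+m]-X m x = begin
    0# + x * (- 1# + x * evalMonic (replicate m 0#) x)  ≡⟨ cong (λ u → 0# + x * (- 1# + x * u)) (evalMonic-replicate m x) ⟩
    0# + x * (- 1# + x * x ^ m)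
      ≡⟨ solve 2 (λ x u → :0 :+ x :* (:- :1 :+ x :* u) := x :* (x :* u) :- x) refl x (x ^ m) ⟩
    x * (x * x ^ m) - x                                 ∎

  remainder : R → R → List R → R
  remainder c a []      = a + c
  remainder c a (b ∷ f) = a + c * remainder c b f

  quotient : R → R → List R → List R
  quotient c a []      = []
  quotient c a (b ∷ f) = remainder c b f ∷ quotient c b f

  length-quotient : ∀ c a f → length (quotient c a f) ≡ length f
  length-quotient c a []      = refl
  length-quotient c a (b ∷ f) = cong suc (length-quotient c b f)

  evalMonic-division : ∀ c a f x →
    evalMonic (a ∷ f) x ≡ (x - c) * evalMonic (quotient c a f) x + remainder c a f
  evalMonic-division c a []      x = solve 3 (λ a x c → a :+ x :* :1 := (x :- c) :* :1 :+ (a :+ c)) refl a x c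
  evalMonic-division c a (b ∷ f) x = begin
    a + x * evalMonic (b ∷ f) x                               ≡⟨ +-congˡ (cong (x *_) (evalMonic-division c b f x)) ⟩
    a + x * ((x - c) * evalMonic (quotient c b f) x + r)
      ≡⟨ solve 5 (λ a x c q r → a :+ x :* ((x :- c) :* q :+ r) := (x :- c) :* (r :+ x :* q) :+ (a :+ c :* r)) refl a x c _ r ⟩
    (x - c) * (r + x * evalMonic (quotient c b f) x) + (a + c * r) ∎
    where
    r : R
    r = remainder c b f

  module IntegralDomain (1≢0 : 1# ≢ 0#) (integral : ∀ {x y} → x ≢ 0# → x * y ≡ 0# → y ≡ 0#) where

    monic-roots-bound : ∀ n f → length f ≡ n → (r : Fin (suc n) → R) → Injective _≡_ _≡_ r →
                        ¬ (∀ i → evalMonic f (r i) ≡ 0#)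
    monic-roots-bound zero    []      _    r r-inj roots = 1≢0 (roots Fin.zero)
    monic-roots-bound (suc n) (a ∷ f) |f|≡n r r-inj roots =
      monic-roots-bound n (quotient c a f) (trans (length-quotient c a f) (ℕP.suc-injective |f|≡n))
        (r ∘ Fin.suc) (FinP.suc-injective ∘ r-inj) quotient-roots
      where
      c : R
      c = r Fin.zero
      remainder≡0 : remainder c a f ≡ 0#
      remainder≡0 = begin
        remainder c a f
          ≡⟨ solve 3 (λ c q s → s := (c :- c) :* q :+ s) refl c (evalMonic (quotient c a f) c) _ ⟩
        (c - c) * evalMonic (quotient c a f) c + remainder c a f ≡⟨ sym (evalMonic-division c a f c) ⟩
        evalMonic (a ∷ f) c                                  ≡⟨ roots Fin.zero ⟩
        0#                                                   ∎
      quotient-roots : ∀ i → evalMonic (quotient c a f) (r (Fin.suc i)) ≡ 0#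
      quotient-roots i = integral (λ x-c≡0 → FinP.0≢1+n (r-inj (sym (x-y≡0⇒x≡y _ _ x-c≡0)))) (begin
        (x - c) * evalMonic (quotient c a f) x                    ≡⟨ sym (trans (+-congˡ remainder≡0) (+-identityʳ _)) ⟩
        (x - c) * evalMonic (quotient c a f) x + remainder c a f  ≡⟨ sym (evalMonic-division c a f x) ⟩
        evalMonic (a ∷ f) x                                      ≡⟨ roots (Fin.suc i) ⟩
        0#                                                       ∎)
        where
        x : R
        x = r (Fin.suc i)

module FieldTheory (F : Field) where

  open Field F public using (Carrier; 0≢1; inverse)
  open CommutativeRingTheory (Field.isCommutativeRing F) public
  open ≡-Reasoning

  fromℕ≡fromℕ′ : ∀ n → Field.fromℕ F n ≡ fromℕ′ n
  fromℕ≡fromℕ′ zero    = refl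
  fromℕ≡fromℕ′ (suc n) = trans (+-congˡ (fromℕ≡fromℕ′ n)) (sym (fromℕ′-suc n))

  fromℤ≡fromℤ′ : ∀ i → Field.fromℤ F i ≡ fromℤ′ i
  fromℤ≡fromℤ′ (+ n)    = fromℕ≡fromℕ′ n
  fromℤ≡fromℤ′ -[1+ n ] = cong -_ (fromℕ≡fromℕ′ (suc n))

  ^≡^ : ∀ x n → Field._^_ F x n ≡ x ^ n
  ^≡^ x zero    = refl
  ^≡^ x (suc n) = cong (x *_) (^≡^ x n)

  sumUpTo≡∑ : ∀ n f → Field.sumUpTo F n f ≡ ∑ n f
  sumUpTo≡∑ n f = go n (λ k → k)
    where
    go : ∀ n g → foldr _+_ 0# (map f (applyUpTo g n)) ≡ ∑ n (f ∘ g)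
    go zero    g = refl
    go (suc n) g = +-congˡ (go n (g ∘ suc))

  1≢0 : 1# ≢ 0#
  1≢0 = 0≢1 ∘ sym

  inv : ∀ {x} → x ≢ 0# → Carrier
  inv x≢0 = proj₁ (inverse _ x≢0)

  inv-cancelʳ : ∀ {x} (x≢0 : x ≢ 0#) y → x * (inv x≢0 * y) ≡ y
  inv-cancelʳ {x} x≢0 y = begin
    x * (inv x≢0 * y)    ≡⟨ sym (*-assoc x _ y) ⟩
    (x * inv x≢0) * y    ≡⟨ cong (_* y) (proj₂ (inverse x x≢0)) ⟩
    1# * y               ≡⟨ *-identityˡ y ⟩
    y                    ∎

  inv-cancelˡ : ∀ {x} (x≢0 : x ≢ 0#) y → inv x≢0 * (x * y) ≡ y
  inv-cancelˡ {x} x≢0 y = begin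
    inv x≢0 * (x * y)    ≡⟨ sym (*-assoc _ x y) ⟩
    (inv x≢0 * x) * y    ≡⟨ cong (_* y) (*-comm _ x) ⟩
    (x * inv x≢0) * y    ≡⟨ *-assoc x _ y ⟩
    x * (inv x≢0 * y)    ≡⟨ inv-cancelʳ x≢0 y ⟩
    y                    ∎

  *-cancelˡ : ∀ {x y w} → x ≢ 0# → x * y ≡ x * w → y ≡ w
  *-cancelˡ {x} {y} {w} x≢0 xy≡xw =
    trans (sym (inv-cancelˡ x≢0 y)) (trans (cong (inv x≢0 *_) xy≡xw) (inv-cancelˡ x≢0 w))

  integral : ∀ {x y} → x ≢ 0# → x * y ≡ 0# → y ≡ 0#
  integral {x} x≢0 xy≡0 = *-cancelˡ x≢0 (trans xy≡0 (sym (zeroʳ x)))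

module FiniteField (F : Field) {q : ℕ} (enumeration : Fin q ↔ Field.Carrier F) where

  open FieldTheory F
  open Inverse enumeration using (strictlyInverseˡ) renaming (to to element; from to index)
  open import Algebra.Properties.CommutativeMonoid.Sum (CommutativeRing.*-commutativeMonoid commutativeRing)
    using (∑-permute; sum-cong-≗; sum-remove; sum-replicate) renaming (sum to ∏; ∑-distrib-+ to ∏-distrib-*)
  open ≡-Reasoning

  infix 4 _≟_
  _≟_ : DecidableEquality Carrier
  _≟_ = via-injection (↔⇒↣ (↔-sym enumeration)) Fin._≟_

  ∏-≢0 : ∀ {n} (f : Fin n → Carrier) → (∀ i → f i ≢ 0#) → ∏ f ≢ 0#
  ∏-≢0 {zero}  f f≢0 = 1≢0
  ∏-≢0 {suc n} f f≢0 f₀∏≡0 = ∏-≢0 (f ∘ Fin.suc) (f≢0 ∘ Fin.suc) (integral (f≢0 Fin.zero) f₀∏≡0)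

  scaling : ∀ {c} → c ≢ 0# → Carrier ↔ Carrier
  scaling {c} c≢0 = mk↔ₛ′ (c *_) (inv c≢0 *_) (inv-cancelʳ c≢0) (inv-cancelˡ c≢0)

  ∏-scaling : ∀ {c} → c ≢ 0# → ∀ g → ∏ (g ∘ element) ≡ ∏ (λ i → g (c * element i))
  ∏-scaling c≢0 g = trans (∑-permute (g ∘ element) (↔-trans enumeration (↔-trans (scaling c≢0) (↔-sym enumeration))))
                          (sum-cong-≗ {q} (λ i → cong g (strictlyInverseˡ _)))

  unitPart : Carrier → Carrier
  unitPart y with y ≟ 0#
  ... | yes _ = 1#
  ... | no  _ = y

  unitPart-≢0 : ∀ y → unitPart y ≢ 0#
  unitPart-≢0 y with y ≟ 0#
  ... | yes _   = 1≢0
  ... | no  y≢0 = y≢0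

  scaleFactor : Carrier → Carrier → Carrier
  scaleFactor c y with y ≟ 0#
  ... | yes _ = 1#
  ... | no  _ = c

  unitPart-* : ∀ {c} → c ≢ 0# → ∀ y → unitPart (c * y) ≡ scaleFactor c y * unitPart y
  unitPart-* {c} c≢0 y with y ≟ 0# | c * y ≟ 0#
  ... | yes _   | yes _    = sym (*-identityˡ 1#)
  ... | yes y≡0 | no  cy≢0 = ⊥-elim (cy≢0 (trans (cong (c *_) y≡0) (zeroʳ c)))
  ... | no  y≢0 | yes cy≡0 = ⊥-elim (y≢0 (integral c≢0 cy≡0))
  ... | no  _   | no  _    = refl

  ∏-scaleFactor : ∀ c {n} (f : Fin n → Carrier) → Injective _≡_ _≡_ f →
                  ∀ i₀ → f i₀ ≡ 0# → ∏ (scaleFactor c ∘ f) * c ≡ c ^ n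
  ∏-scaleFactor c {suc n} f f-inj i₀ fi₀≡0 = begin
    ∏ (scaleFactor c ∘ f) * c                                         ≡⟨ cong (_* c) (sum-remove (scaleFactor c ∘ f)) ⟩
    (scaleFactor c (f i₀) * ∏ (scaleFactor c ∘ f ∘ Fin.punchIn i₀)) * c
      ≡⟨ cong (λ x → x * c) (cong₂ _*_ at-zero (sum-cong-≗ {n} elsewhere)) ⟩
    (1# * ∏ {n} (λ _ → c)) * c
      ≡⟨ cong (_* c) (trans (*-identityˡ _) (sum-replicate n)) ⟩
    c ^ n * c                                                         ≡⟨ *-comm _ c ⟩
    c ^ suc n                                                         ∎
    where
    at-zero : scaleFactor c (f i₀) ≡ 1#
    at-zero with f i₀ ≟ 0#
    ... | yes _     = refl
    ... | no  fi₀≢0 = ⊥-elim (fi₀≢0 fi₀≡0)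
    elsewhere : ∀ j → scaleFactor c (f (Fin.punchIn i₀ j)) ≡ c
    elsewhere j with f (Fin.punchIn i₀ j) ≟ 0#
    ... | yes fj≡0 = ⊥-elim (FinP.punchInᵢ≢i i₀ j (f-inj (trans fj≡0 (sym fi₀≡0))))
    ... | no  _    = refl

  -- Scaling by c ≠ 0 permutes F, so it fixes the product P of the units but multiplies it by c^(q − 1).
  fermat : ∀ c → c ^ q ≡ c
  fermat c with c ≟ 0# | index 0#
  ... | yes refl | Fin.zero  = zeroˡ _
  ... | yes refl | Fin.suc _ = zeroˡ _
  ... | no  c≢0  | _         = begin
    c ^ q
      ≡⟨ sym (∏-scaleFactor c element (Injection.injective (↔⇒↣ enumeration)) (index 0#) (strictlyInverseˡ 0#)) ⟩
    K * c                     ≡⟨ cong (_* c) K≡1 ⟩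
    1# * c                    ≡⟨ *-identityˡ c ⟩
    c                         ∎
    where
    K P : Carrier
    K = ∏ (scaleFactor c ∘ element)
    P = ∏ (unitPart ∘ element)
    P≡K*P : P ≡ K * P
    P≡K*P = begin
      P                                                              ≡⟨ ∏-scaling c≢0 unitPart ⟩
      ∏ (λ i → unitPart (c * element i))                             ≡⟨ sum-cong-≗ (unitPart-* c≢0 ∘ element) ⟩
      ∏ (λ i → scaleFactor c (element i) * unitPart (element i))
        ≡⟨ ∏-distrib-* (scaleFactor c ∘ element) (unitPart ∘ element) ⟩
      K * P                                                          ∎
    K≡1 : K ≡ 1#
    K≡1 = *-cancelˡ (∏-≢0 (unitPart ∘ element) (unitPart-≢0 ∘ element))
            (trans (*-comm P K) (trans (sym P≡K*P) (sym (*-identityʳ P))))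

module QuadraticExtension (F : Field) (z : Field.Carrier F) where

  open FieldTheory F
  open ≡-Reasoning

  -- (a , b) stands for a τ + b, where τ² = τ + z.
  E : Set
  E = Carrier × Carrier

  infixl 7 _⊗_
  infixl 6 _⊕_
  infix  8 ⊖_

  _⊕_ _⊗_ : E → E → E
  (a , b) ⊕ (c , d) = (a + c , b + d)
  (a , b) ⊗ (c , d) = (a * c + a * d + b * c , a * c * z + b * d)

  ⊖_ : E → E
  ⊖ (a , b) = (- a , - b)

  𝟘 𝟙 τ : E
  𝟘 = (0# , 0#)
  𝟙 = (0# , 1#)
  τ = (1# , 0#)

  ι : Carrier → E
  ι c = (0# , c)

  module Symbolic {n : ℕ} where
    Pair : Set
    Pair = Polynomial n × Polynomial n
    _⊕ᴾ_ : Pair → Pair → Pair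
    (a , b) ⊕ᴾ (c , d) = (a :+ c , b :+ d)
    τᴾ : Pair
    τᴾ = (:1 , :0)
    ιᴾ : Polynomial n → Pair
    ιᴾ c = (:0 , c)
    mulᴾ : Polynomial n → Pair → Pair → Pair
    mulᴾ z (a , b) (c , d) = (a :* c :+ a :* d :+ b :* c , a :* c :* z :+ b :* d)
  open Symbolic

  ⊗-comm : ∀ x y → x ⊗ y ≡ y ⊗ x
  ⊗-comm (a , b) (c , d) = cong₂ _,_
    (solve 5 (λ a b c d z → proj₁ (mulᴾ z (a , b) (c , d)) := proj₁ (mulᴾ z (c , d) (a , b))) refl a b c d z)
    (solve 5 (λ a b c d z → proj₂ (mulᴾ z (a , b) (c , d)) := proj₂ (mulᴾ z (c , d) (a , b))) refl a b c d z)

  ⊗-assoc : ∀ x y w → (x ⊗ y) ⊗ w ≡ x ⊗ (y ⊗ w)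
  ⊗-assoc (a , b) (c , d) (e , f) = cong₂ _,_
    (solve 7 (λ a b c d e f z → proj₁ (mulᴾ z (mulᴾ z (a , b) (c , d)) (e , f))
                             := proj₁ (mulᴾ z (a , b) (mulᴾ z (c , d) (e , f)))) refl a b c d e f z)
    (solve 7 (λ a b c d e f z → proj₂ (mulᴾ z (mulᴾ z (a , b) (c , d)) (e , f))
                             := proj₂ (mulᴾ z (a , b) (mulᴾ z (c , d) (e , f)))) refl a b c d e f z)

  ⊗-identityˡ : ∀ x → 𝟙 ⊗ x ≡ x
  ⊗-identityˡ (c , d) = cong₂ _,_
    (solve 3 (λ c d z → proj₁ (mulᴾ z (:0 , :1) (c , d)) := c) refl c d z)
    (solve 3 (λ c d z → proj₂ (mulᴾ z (:0 , :1) (c , d)) := d) refl c d z)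

  ⊗-distribˡ : ∀ x y w → x ⊗ (y ⊕ w) ≡ x ⊗ y ⊕ x ⊗ w
  ⊗-distribˡ (a , b) (c , d) (e , f) = cong₂ _,_
    (solve 7 (λ a b c d e f z → proj₁ (mulᴾ z (a , b) ((c , d) ⊕ᴾ (e , f)))
                             := proj₁ (mulᴾ z (a , b) (c , d) ⊕ᴾ mulᴾ z (a , b) (e , f))) refl a b c d e f z)
    (solve 7 (λ a b c d e f z → proj₂ (mulᴾ z (a , b) ((c , d) ⊕ᴾ (e , f)))
                             := proj₂ (mulᴾ z (a , b) (c , d) ⊕ᴾ mulᴾ z (a , b) (e , f))) refl a b c d e f z)

  isCommutativeRingᴱ : IsCommutativeRing _≡_ _⊕_ _⊗_ ⊖_ 𝟘 𝟙
  isCommutativeRingᴱ = record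
    { isRing = record
      { +-isAbelianGroup = record
        { isGroup = record
          { isMonoid = record
            { isSemigroup = record
              { isMagma = record { isEquivalence = isEquivalence ; ∙-cong = cong₂ _⊕_ }
              ; assoc = λ (a , b) (c , d) (e , f) → cong₂ _,_ (+-assoc a c e) (+-assoc b d f) }
            ; identity = (λ (a , b) → cong₂ _,_ (+-identityˡ a) (+-identityˡ b))
                       , (λ (a , b) → cong₂ _,_ (+-identityʳ a) (+-identityʳ b)) }
          ; inverse = (λ (a , b) → cong₂ _,_ (-‿inverseˡ a) (-‿inverseˡ b))
                    , (λ (a , b) → cong₂ _,_ (-‿inverseʳ a) (-‿inverseʳ b))
          ; ⁻¹-cong = cong ⊖_ }
        ; comm = λ (a , b) (c , d) → cong₂ _,_ (+-comm a c) (+-comm b d) }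
      ; *-cong = cong₂ _⊗_
      ; *-assoc = ⊗-assoc
      ; *-identity = ⊗-identityˡ , (λ x → trans (⊗-comm x 𝟙) (⊗-identityˡ x))
      ; distrib = ⊗-distribˡ
                , (λ w x y → trans (⊗-comm (x ⊕ y) w)
                                   (trans (⊗-distribˡ w x y) (cong₂ _⊕_ (⊗-comm w x) (⊗-comm w y)))) }
    ; *-comm = ⊗-comm }

  module ℰ = CommutativeRingTheory isCommutativeRingᴱ
  open ℰ public using () renaming (_^_ to _^ᴱ_)

  ι-+ : ∀ c d → ι (c + d) ≡ ι c ⊕ ι d
  ι-+ c d = cong (_, c + d) (sym (+-identityˡ 0#))

  ι-* : ∀ c d → ι (c * d) ≡ ι c ⊗ ι d
  ι-* c d = cong₂ _,_
    (solve 2 (λ c d → :0 := :0 :* :0 :+ :0 :* d :+ c :* :0) refl c d)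
    (solve 3 (λ c d z → c :* d := :0 :* :0 :* z :+ c :* d) refl c d z)

  ι-^ : ∀ c n → ι c ^ᴱ n ≡ ι (c ^ n)
  ι-^ c zero    = refl
  ι-^ c (suc n) = trans (cong (ι c ⊗_) (ι-^ c n)) (sym (ι-* c (c ^ n)))

  ι-fromℕ′ : ∀ n → ℰ.fromℕ′ n ≡ ι (fromℕ′ n)
  ι-fromℕ′ zero    = refl
  ι-fromℕ′ (suc n) = begin
    ℰ.fromℕ′ (suc n)          ≡⟨ ℰ.fromℕ′-suc n ⟩
    𝟙 ⊕ ℰ.fromℕ′ n            ≡⟨ cong (𝟙 ⊕_) (ι-fromℕ′ n) ⟩
    ι 1# ⊕ ι (fromℕ′ n)       ≡⟨ sym (ι-+ 1# (fromℕ′ n)) ⟩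
    ι (1# + fromℕ′ n)         ≡⟨ cong ι (sym (fromℕ′-suc n)) ⟩
    ι (fromℕ′ (suc n))        ∎

  τ⊗τ : τ ⊗ τ ≡ τ ⊕ ι z
  τ⊗τ = cong₂ _,_
    (solve 0 (:1 :* :1 :+ :1 :* :0 :+ :0 :* :1 := :1 :+ :0) refl)
    (solve 1 (λ z → :1 :* :1 :* z :+ :0 :* :0 := :0 :+ z) refl z)

  proj₁-τ⊗ : ∀ a b → proj₁ (τ ⊗ (a , b)) ≡ a + b
  proj₁-τ⊗ a b = solve 2 (λ a b → :1 :* a :+ :1 :* b :+ :0 :* a := a :+ b) refl a b

  τ^[1+n] : ∀ n → τ ^ᴱ suc n ≡ (fibonacci z n , fibonacci z (suc n) - fibonacci z n)
  τ^[1+n] zero = trans (ℰ.*-identityʳ τ) (cong₂ _,_ (sym (fibonacci-0 z))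
    (sym (trans (cong₂ _-_ (fibonacci-1 z) (fibonacci-0 z)) (-‿inverseʳ 1#))))
  τ^[1+n] (suc n) = begin
    τ ⊗ τ ^ᴱ suc n                    ≡⟨ cong (τ ⊗_) (τ^[1+n] n) ⟩
    τ ⊗ (a , b - a)
      ≡⟨ cong₂ _,_ (trans (proj₁-τ⊗ a (b - a)) (solve 2 (λ a b → a :+ (b :- a) := b) refl a b))
                                                  (solve 3 (λ a b z → :1 :* a :* z :+ :0 :* (b :- a) := (b :+ z :* a) :- b) refl a b z) ⟩
    (b , (b + z * a) - b)             ≡⟨ cong (λ c → (b , c - b)) (sym (fibonacci-rec z n)) ⟩
    (b , fibonacci z (suc (suc n)) - b) ∎
    where
    a b : Carrier
    a = fibonacci z n
    b = fibonacci z (suc n)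

  norm : E → Carrier
  norm (a , b) = b * b + a * b - a * a * z

  norm-⊗ : ∀ x y → norm (x ⊗ y) ≡ norm x * norm y
  norm-⊗ (a , b) (c , d) = solve 5 (λ a b c d z →
    let (A , B) = mulᴾ z (a , b) (c , d) in
    B :* B :+ A :* B :- A :* A :* z := (b :* b :+ a :* b :- a :* a :* z) :* (d :* d :+ c :* d :- c :* c :* z)) refl a b c d z

  module WithoutRoots (_≟_ : DecidableEquality Carrier) (no-root : ∀ r → r * r + r + - z ≢ 0#) where

    square≡0 : ∀ {b} → b * b ≡ 0# → b ≡ 0#
    square≡0 {b} b²≡0 with b ≟ 0#
    ... | yes b≡0 = b≡0
    ... | no  b≢0 = integral b≢0 b²≡0

    norm≡0 : ∀ x → norm x ≡ 0# → x ≡ 𝟘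
    norm≡0 (a , b) N≡0 with a ≟ 0#
    ... | yes refl = cong (0# ,_) (square≡0 (begin
      b * b                              ≡⟨ solve 2 (λ b z → b :* b := b :* b :+ :0 :* b :- :0 :* :0 :* z) refl b z ⟩
      norm (0# , b)                      ≡⟨ N≡0 ⟩
      0#                                 ∎))
    ... | no  a≢0 = ⊥-elim (no-root u (integral (λ a²≡0 → a≢0 (square≡0 a²≡0)) (begin
      a * a * (u * u + u + - z)
        ≡⟨ solve 3 (λ a u z → a :* a :* (u :* u :+ u :+ :- z) := (a :* u) :* (a :* u) :+ a :* (a :* u) :- a :* a :* z) refl a u z ⟩
      (a * u) * (a * u) + a * (a * u) - a * a * z ≡⟨ cong (λ v → v * v + a * v - a * a * z) (inv-cancelʳ a≢0 b) ⟩
      norm (a , b)                         ≡⟨ N≡0 ⟩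
      0#                                   ∎)))
      where
      u : Carrier
      u = inv a≢0 * b

    ⊗-integral : ∀ {x y} → x ≢ 𝟘 → x ⊗ y ≡ 𝟘 → y ≡ 𝟘
    ⊗-integral {x} {y} x≢0 xy≡0 = norm≡0 y (integral (x≢0 ∘ norm≡0 x) (begin
      norm x * norm y                      ≡⟨ sym (norm-⊗ x y) ⟩
      norm (x ⊗ y)                         ≡⟨ cong norm xy≡0 ⟩
      norm 𝟘                               ≡⟨ solve 1 (λ z → :0 :* :0 :+ :0 :* :0 :- :0 :* :0 :* z := :0) refl z ⟩
      0#                                   ∎))

module SumOfBinomials (F : Field) (p q : ℕ) (isFiniteField : IsFiniteField F p q) (z : Field.Carrier F) where

  open IsFiniteField isFiniteField
  open FieldTheory F
  open FiniteField F enumeration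
  open Inverse enumeration using () renaming (to to element)
  open QuadraticExtension F z
  open Symbolic
  open ≡-Reasoning

  S : Carrier
  S = Field.sumUpTo F (suc (q / 2)) (λ k → Field.fromℤ F (gbinom (ℤ.- (+ k)) k) * Field._^_ F z k)

  instance
    p-nonZero : NonZero p
    p-nonZero = prime⇒nonZero p-prime

  2≤q : 2 ≤ q
  2≤q = subst (2 ≤_) (sym q≡p^n) (ℕP.≤-trans 2≤p (ℕP.^-monoʳ-≤ p exponent-pos))
    where
    2≤p : 2 ≤ p ℕ.^ 1
    2≤p = subst (2 ≤_) (sym (ℕP.*-identityʳ p)) (ℕ.nonTrivial⇒n>1 p {{prime⇒nonTrivial p-prime}})

  q≡1+[q∸1] : q ≡ suc (q ∸ 1)
  q≡1+[q∸1] = sym (ℕP.m+[n∸m]≡n (ℕP.≤-trans (s≤s z≤n) 2≤q))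

  char-p′ : fromℕ′ p ≡ 0#
  char-p′ = trans (sym (fromℕ≡fromℕ′ p)) char-p

  open Characteristic p-prime char-p′ using (choose-periodic)
  open ℰ.Characteristic p-prime (trans (ι-fromℕ′ p) (cong ι char-p′)) using (frobenius)

  choose-q-periodic : ∀ m k → k < q → choose (+ q ℤ.+ m) k ≡ choose m k
  choose-q-periodic m k = subst (λ n → k < n → choose (+ n ℤ.+ m) k ≡ choose m k) (sym q≡p^n) (choose-periodic exponent m k)

  frobeniusᴱ : ∀ x y → (x ⊕ y) ^ᴱ q ≡ x ^ᴱ q ⊕ y ^ᴱ q
  frobeniusᴱ x y = subst (λ n → (x ⊕ y) ^ᴱ n ≡ x ^ᴱ n ⊕ y ^ᴱ n) (sym q≡p^n) (frobenius exponent x y)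

  ι-fermat : ∀ c → ι c ^ᴱ q ≡ ι c
  ι-fermat c = trans (ι-^ c q) (cong ι (fermat c))

  gbinom-term : ∀ k → k < q → Field.fromℤ F (gbinom (ℤ.- (+ k)) k) ≡ fromℕ′ ((q ∸ k) C k)
  gbinom-term zero    _   = fromℤ≡fromℤ′ (+ 1)
  gbinom-term (suc k) k<q = begin
    Field.fromℤ F (gbinom -[1+ k ] (suc k))  ≡⟨ fromℤ≡fromℤ′ (gbinom -[1+ k ] (suc k)) ⟩
    fromℤ′ (gbinom -[1+ k ] (suc k))         ≡⟨ fromℤ′-gbinom-neg k (suc k) ⟩
    choose -[1+ k ] (suc k)                  ≡⟨ sym (choose-q-periodic -[1+ k ] (suc k) k<q) ⟩
    choose (+ q ℤ.+ -[1+ k ]) (suc k)        ≡⟨ cong (λ i → choose i (suc k)) (ℤP.⊖-≥ (ℕP.<⇒≤ k<q)) ⟩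
    choose (+ (q ∸ suc k)) (suc k)           ∎

  S≡fibonacci : S ≡ fibonacci z q
  S≡fibonacci = begin
    S                                                       ≡⟨ sumUpTo≡∑ (suc (q / 2)) _ ⟩
    ∑ (suc (q / 2)) (λ k → Field.fromℤ F (gbinom (ℤ.- (+ k)) k) * Field._^_ F z k)
      ≡⟨ ∑-cong (suc (q / 2)) (λ k k≤q/2 → cong₂ _*_ (gbinom-term k (k<q (ℕP.≤-pred k≤q/2))) (^≡^ z k)) ⟩
    ∑ (suc (q / 2)) (λ k → fromℕ′ ((q ∸ k) C k) * z ^ k)    ≡⟨ ∑-extend (suc (q / 2)) (suc q) (s≤s (m/n≤m q 2)) beyond-half ⟩
    fibonacci z q                                           ∎
    where
    k<q : ∀ {k} → k ≤ q / 2 → k < q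
    k<q k≤q/2 = ℕP.≤-<-trans k≤q/2 (m/n<m q 2 {{ℕ.>-nonZero (ℕP.≤-trans (s≤s z≤n) 2≤q)}} (s≤s (s≤s z≤n)))
    beyond-half : ∀ k → suc (q / 2) ≤ k → k < suc q → fromℕ′ ((q ∸ k) C k) * z ^ k ≡ 0#
    beyond-half k q/2<k _ = trans (cong (λ c → fromℕ′ c * z ^ k) (k>n⇒nCk≡0 ([m/2<k]⇒m∸k<k q k q/2<k))) (zeroˡ _)

  S≡proj₁[τ⊗τ^q] : S ≡ proj₁ (τ ⊗ τ ^ᴱ q)
  S≡proj₁[τ⊗τ^q] = trans S≡fibonacci (sym (cong proj₁ (τ^[1+n] q)))

  module Root (r : Carrier) (root : r * r + r + - z ≡ 0#) where

    δ : Carrier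
    δ = 1# + r + r

    w : E
    w = τ ⊕ ι r

    w⊗w : w ⊗ w ≡ ι δ ⊗ w
    w⊗w = cong₂ _,_
      (solve 2 (λ r z → let w = τᴾ ⊕ᴾ ιᴾ r in proj₁ (mulᴾ z w w) := proj₁ (mulᴾ z (ιᴾ (:1 :+ r :+ r)) w)) refl r z)
      (begin
        proj₂ (w ⊗ w)                          ≡⟨ solve 2 (λ r z → let w = τᴾ ⊕ᴾ ιᴾ r in
                                                    proj₂ (mulᴾ z w w) := proj₂ (mulᴾ z (ιᴾ (:1 :+ r :+ r)) w) :- (r :* r :+ r :+ :- z)) refl r z ⟩
        proj₂ (ι δ ⊗ w) - (r * r + r + - z)    ≡⟨ cong (λ u → proj₂ (ι δ ⊗ w) - u) root ⟩
        proj₂ (ι δ ⊗ w) - 0#                   ≡⟨ x-0≡x _ ⟩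
        proj₂ (ι δ ⊗ w)                        ∎)

    w^[1+n] : ∀ n → w ^ᴱ suc n ≡ ι (δ ^ n) ⊗ w
    w^[1+n] zero    = trans (ℰ.*-identityʳ w) (sym (⊗-identityˡ w))
    w^[1+n] (suc n) = begin
      w ⊗ w ^ᴱ suc n               ≡⟨ cong (w ⊗_) (w^[1+n] n) ⟩
      w ⊗ (ι (δ ^ n) ⊗ w)          ≡⟨ ℰ.solve 2 (λ w d → w ℰ.:* (d ℰ.:* w) ℰ.:= d ℰ.:* (w ℰ.:* w)) refl w (ι (δ ^ n)) ⟩
      ι (δ ^ n) ⊗ (w ⊗ w)          ≡⟨ cong (ι (δ ^ n) ⊗_) w⊗w ⟩
      ι (δ ^ n) ⊗ (ι δ ⊗ w)        ≡⟨ sym (ℰ.*-assoc _ _ w) ⟩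
      (ι (δ ^ n) ⊗ ι δ) ⊗ w        ≡⟨ cong (_⊗ w) (trans (⊗-comm _ _) (sym (ι-* δ (δ ^ n)))) ⟩
      ι (δ ^ suc n) ⊗ w            ∎

    τ^q-expansion : τ ^ᴱ q ≡ ι (δ ^ (q ∸ 1)) ⊗ w ⊕ ι (- r)
    τ^q-expansion = begin
      τ ^ᴱ q                                  ≡⟨ cong (_^ᴱ q) τ≡w-r ⟩
      (w ⊕ ι (- r)) ^ᴱ q                      ≡⟨ frobeniusᴱ w (ι (- r)) ⟩
      w ^ᴱ q ⊕ ι (- r) ^ᴱ q
        ≡⟨ cong₂ _⊕_ (subst (λ n → w ^ᴱ n ≡ ι (δ ^ (q ∸ 1)) ⊗ w) (sym q≡1+[q∸1]) (w^[1+n] (q ∸ 1))) (ι-fermat (- r)) ⟩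
      ι (δ ^ (q ∸ 1)) ⊗ w ⊕ ι (- r)           ∎
      where
      τ≡w-r : τ ≡ w ⊕ ι (- r)
      τ≡w-r = cong₂ _,_ (solve 0 (:1 := (:1 :+ :0) :+ :0) refl)
                        (solve 1 (λ r → :0 := (:0 :+ r) :+ :- r) refl r)

    S-via-root : S ≡ δ ^ (q ∸ 1) * (1# + r) - r
    S-via-root = begin
      S                                                   ≡⟨ S≡proj₁[τ⊗τ^q] ⟩
      proj₁ (τ ⊗ τ ^ᴱ q)                                  ≡⟨ cong (proj₁ ∘ (τ ⊗_)) τ^q-expansion ⟩
      proj₁ (τ ⊗ (ι (δ ^ (q ∸ 1)) ⊗ w ⊕ ι (- r)))
        ≡⟨ solve 3 (λ c r z → proj₁ (mulᴾ z τᴾ (mulᴾ z (ιᴾ c) (τᴾ ⊕ᴾ ιᴾ r) ⊕ᴾ ιᴾ (:- r))) := c :* (:1 :+ r) :- r) refl (δ ^ (q ∸ 1)) r z ⟩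
      δ ^ (q ∸ 1) * (1# + r) - r                          ∎

  root-of-factorisation : ∀ {r₁ r₂} → r₁ + r₂ ≡ - 1# → r₁ * r₂ ≡ - z → r₁ * r₁ + r₁ + - z ≡ 0#
  root-of-factorisation {r₁} {r₂} sum product = begin
    r₁ * r₁ + r₁ + - z
      ≡⟨ solve 3 (λ a b z → a :* a :+ a :+ :- z := a :* (a :+ b :+ :1) :- (a :* b :+ z)) refl r₁ r₂ z ⟩
    r₁ * (r₁ + r₂ + 1#) - (r₁ * r₂ + z)  ≡⟨ cong₂ (λ u v → r₁ * u - v) (x≡-y⇒x+y≡0 sum) (x≡-y⇒x+y≡0 product) ⟩
    r₁ * 0# - 0#                         ≡⟨ trans (x-0≡x _) (zeroʳ r₁) ⟩
    0#                                   ∎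

  S-double-root : ∀ r → r + r ≡ - 1# → r * r ≡ - z → S * (1# + 1#) ≡ 1#
  S-double-root r sum product = begin
    S * (1# + 1#)                               ≡⟨ cong (_* (1# + 1#)) S-via-root ⟩
    (δ ^ (q ∸ 1) * (1# + r) - r) * (1# + 1#)    ≡⟨ cong (λ c → (c * (1# + r) - r) * (1# + 1#)) c≡0 ⟩
    (0# * (1# + r) - r) * (1# + 1#)
      ≡⟨ solve 1 (λ r → (:0 :* (:1 :+ r) :- r) :* (:1 :+ :1) := :- (r :+ r)) refl r ⟩
    - (r + r)                                   ≡⟨ cong -_ sum ⟩
    - - 1#                                      ≡⟨ -‿involutive 1# ⟩
    1#                                          ∎
    where
    open Root r (root-of-factorisation sum product)
    c≡0 : δ ^ (q ∸ 1) ≡ 0#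
    c≡0 = begin
      δ ^ (q ∸ 1)         ≡⟨ cong₂ _^_ (trans (solve 1 (λ r → :1 :+ r :+ r := r :+ r :+ :1) refl r) (x≡-y⇒x+y≡0 sum))
                                       (ℕP.+-∸-assoc 1 2≤q) ⟩
      0# ^ suc (q ∸ 2)    ≡⟨ zeroˡ _ ⟩
      0#                  ∎

  S-distinct-roots : ∀ r₁ r₂ → r₁ ≢ r₂ → r₁ + r₂ ≡ - 1# → r₁ * r₂ ≡ - z → S ≡ 1#
  S-distinct-roots r₁ r₂ r₁≢r₂ sum product = begin
    S                                      ≡⟨ S-via-root ⟩
    δ ^ (q ∸ 1) * (1# + r₁) - r₁           ≡⟨ cong (λ c → c * (1# + r₁) - r₁) c≡1 ⟩
    1# * (1# + r₁) - r₁                    ≡⟨ solve 1 (λ r → :1 :* (:1 :+ r) :- r := :1) refl r₁ ⟩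
    1#                                     ∎
    where
    open Root r₁ (root-of-factorisation sum product)
    δ≢0 : δ ≢ 0#
    δ≢0 δ≡0 = r₁≢r₂ (x-y≡0⇒x≡y r₁ r₂ (begin
      r₁ - r₂                  ≡⟨ solve 2 (λ a b → a :- b := (:1 :+ a :+ a) :- (a :+ b :+ :1)) refl r₁ r₂ ⟩
      δ - (r₁ + r₂ + 1#)       ≡⟨ cong₂ _-_ δ≡0 (x≡-y⇒x+y≡0 sum) ⟩
      0# - 0#                  ≡⟨ -‿inverseʳ 0# ⟩
      0#                       ∎))
    c≡1 : δ ^ (q ∸ 1) ≡ 1#
    c≡1 = *-cancelˡ δ≢0 (begin
      δ * δ ^ (q ∸ 1)     ≡⟨ subst (λ n → δ ^ n ≡ δ) q≡1+[q∸1] (fermat δ) ⟩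
      δ                   ≡⟨ sym (*-identityʳ δ) ⟩
      δ * 1#              ∎)

  τ^q≢τ : (∀ r → r * r + r + - z ≢ 0#) → τ ^ᴱ q ≢ τ
  τ^q≢τ no-root τ^q≡τ = ℰ.IntegralDomain.monic-roots-bound 𝟙≢𝟘 ⊗-integral
    q X^q-X |X^q-X|≡q roots roots-injective roots-vanish
    where
    open WithoutRoots _≟_ no-root
    𝟙≢𝟘 : 𝟙 ≢ 𝟘
    𝟙≢𝟘 = 1≢0 ∘ cong proj₂
    X^q-X : List E
    X^q-X = 𝟘 ∷ ⊖ 𝟙 ∷ replicate (q ∸ 2) 𝟘
    |X^q-X|≡q : length X^q-X ≡ q
    |X^q-X|≡q = trans (cong (2 ℕ.+_) (length-replicate (q ∸ 2))) (ℕP.m+[n∸m]≡n 2≤q)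
    roots : Fin (suc q) → E
    roots Fin.zero    = τ
    roots (Fin.suc i) = ι (element i)
    roots-injective : Injective _≡_ _≡_ roots
    roots-injective {Fin.zero}  {Fin.zero}  _  = refl
    roots-injective {Fin.zero}  {Fin.suc j} eq = ⊥-elim (1≢0 (cong proj₁ eq))
    roots-injective {Fin.suc i} {Fin.zero}  eq = ⊥-elim (1≢0 (sym (cong proj₁ eq)))
    roots-injective {Fin.suc i} {Fin.suc j} eq = cong Fin.suc (Injection.injective (↔⇒↣ enumeration) (cong proj₂ eq))
    roots-fixed : ∀ i → roots i ^ᴱ q ≡ roots i
    roots-fixed Fin.zero    = τ^q≡τ
    roots-fixed (Fin.suc i) = ι-fermat (element i)
    roots-vanish : ∀ i → ℰ.evalMonic X^q-X (roots i) ≡ 𝟘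
    roots-vanish i = begin
      ℰ.evalMonic X^q-X x                 ≡⟨ ℰ.evalMonic-X^[2+m]-X (q ∸ 2) x ⟩
      x ^ᴱ (2 ℕ.+ (q ∸ 2)) ℰ.- x          ≡⟨ cong (λ n → x ^ᴱ n ℰ.- x) (ℕP.m+[n∸m]≡n 2≤q) ⟩
      x ^ᴱ q ℰ.- x                        ≡⟨ ℰ.x≡y⇒x-y≡0 (roots-fixed i) ⟩
      𝟘                                   ∎
      where
      x : E
      x = roots i

  S-no-root : (∀ r → r * r + r + - z ≢ 0#) → S ≡ 0#
  S-no-root no-root = begin
    S                          ≡⟨ S≡proj₁[τ⊗τ^q] ⟩
    proj₁ (τ ⊗ x)              ≡⟨ cong (proj₁ ∘ (τ ⊗_)) x≡1-τ ⟩
    proj₁ (τ ⊗ (𝟙 ℰ.- τ))      ≡⟨ solve 1 (λ z → proj₁ (mulᴾ z τᴾ ((:0 , :1) ⊕ᴾ (:- :1 , :- :0))) := :0) refl z ⟩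
    0#                         ∎
    where
    open WithoutRoots _≟_ no-root
    x : E
    x = τ ^ᴱ q
    x⊗x : x ⊗ x ≡ x ⊕ ι z
    x⊗x = begin
      x ⊗ x                 ≡⟨ sym (ℰ.^-distrib-* τ τ q) ⟩
      (τ ⊗ τ) ^ᴱ q          ≡⟨ cong (_^ᴱ q) τ⊗τ ⟩
      (τ ⊕ ι z) ^ᴱ q        ≡⟨ frobeniusᴱ τ (ι z) ⟩
      x ⊕ ι z ^ᴱ q          ≡⟨ cong (x ⊕_) (ι-fermat z) ⟩
      x ⊕ ι z               ∎
    factorisation : (x ℰ.- τ) ⊗ (x ℰ.- (𝟙 ℰ.- τ)) ≡ 𝟘
    factorisation = begin
      (x ℰ.- τ) ⊗ (x ℰ.- (𝟙 ℰ.- τ))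
        ≡⟨ ℰ.solve 3 (λ x t w → (x ℰ.:- t) ℰ.:* (x ℰ.:- (ℰ.:1 ℰ.:- t)) ℰ.:= (x ℰ.:* x ℰ.:- (x ℰ.:+ w)) ℰ.:- (t ℰ.:* t ℰ.:- (t ℰ.:+ w))) refl x τ (ι z) ⟩
      (x ⊗ x ℰ.- (x ⊕ ι z)) ℰ.- (τ ⊗ τ ℰ.- (τ ⊕ ι z)) ≡⟨ cong₂ ℰ._-_ (ℰ.x≡y⇒x-y≡0 x⊗x) (ℰ.x≡y⇒x-y≡0 τ⊗τ) ⟩
      𝟘 ℰ.- 𝟘                                        ≡⟨ ℰ.-‿inverseʳ 𝟘 ⟩
      𝟘                                              ∎
    x≡1-τ : x ≡ 𝟙 ℰ.- τ
    x≡1-τ = ℰ.x-y≡0⇒x≡y _ _ (⊗-integral (τ^q≢τ no-root ∘ ℰ.x-y≡0⇒x≡y _ _) factorisation)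

lemma5p1 : (F : Field) (p q : ℕ) → IsFiniteField F p q → (z : Field.Carrier F) →
  let open Field F
      S = sumUpTo (suc (q / 2)) (λ k → fromℤ (gbinom (ℤ.- (+ k)) k) * (z ^ k))
  in ¬ (z ≡ 0#) →
     ((r : Carrier) → r + r ≡ - 1# → r * r ≡ - z → S * (1# + 1#) ≡ 1#)
     × ((r₁ r₂ : Carrier) → ¬ (r₁ ≡ r₂) → r₁ + r₂ ≡ - 1# → r₁ * r₂ ≡ - z → S ≡ 1#)
     × (((r : Carrier) → ¬ (r * r + r + - z ≡ 0#)) → S ≡ 0#)
lemma5p1 F p q isFiniteField z _ = S-double-root , S-distinct-roots , S-no-root
  where open SumOfBinomials F p q isFiniteField z
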